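{- If $G$ is a connected finite simple graph, then $\lambda(\mathcal{D}[G])\ge 2\lambda(G)$, where $\lambda$ denotes edge-connectivity.
   Context: The total graph $T_2$ is $K_2$ with a loop added at each of its two vertices. The double graph is $\mathcal{D}[G]=G\times T_2$ (Kronecker product): it has vertex set $V(G)\times\{0,1\}$ and $(u,i)$ is adjacent to $(v,j)$ iff $uv\in E(G)$. -}

module Defs where

open import Data.Nat using (ℕ; _<_)
open import Data.Fin using (Fin)
open import Data.Product using (Σ; _×_; _,_)
open import Data.List using (List; length)
open import Data.List.Membership.Propositional using (_∈_)
open import Relation.Binary.PropositionalEquality using (_≡_; _≢_)
open import Relation.Binary.Construct.Closure.ReflexiveTransitive using (Star)
open import Relation.Nullary using (¬_)

record SimpleGraph (n : ℕ) : Set₁ where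
  field
    Adj   : Fin n → Fin n → Set
    sym   : ∀ {u v} → Adj u v → Adj v u
    irrefl : ∀ {u} → ¬ Adj u u

open SimpleGraph public

Connected : {V : Set} → (V → V → Set) → Set
Connected {V} A = (u v : V) → Star A u v

deleteEdges : {V : Set} → (V → V → Set) → List (V × V) → V → V → Set
deleteEdges A F u v = A u v × (¬ ((u , v) ∈ F)) × (¬ ((v , u) ∈ F))

-- A set of fewer than k edges
-- is represented by a list of length < k (duplicates / non-edges only increase
-- the length, so this quantifies over exactly the edge sets of size < k).
KEdgeConnected : {V : Set} → (V → V → Set) → ℕ → Set
KEdgeConnected {V} A k =
  (Σ V λ u → Σ V λ v → u ≢ v) ×
  ((F : List (V × V)) → length F < k → Connected (deleteEdges A F))

DoubleAdj : {n : ℕ} → SimpleGraph n → (Fin n × Fin 2) → (Fin n × Fin 2) → Set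
DoubleAdj G (u , _) (v , _) = Adj G u v

-- Split F by which copy of G its edges live in: one copy, say layer c, receives
-- fewer than k of them, so layer c minus F is connected because G is
-- k-edge-connected.  Every vertex (u, d) of the other layer still reaches layer c:
-- the F-edges from (u, d) into layer c and the remaining F-edges cannot both
-- number k or more.  If the former are few, some neighbour b of u in G survives
-- and (u, d) — (b, c) is an edge of D[G] − F; if the latter are few, a neighbour a
-- of u and a neighbour b of a survive, giving (u, d) — (a, d) — (b, c).
module Submission where

open import Defs hiding (sym)
open import Level using (0ℓ)
open import Function using (_∘_)
open import Data.Nat using (ℕ; _*_; _+_; _≤_; _<_; z≤n; s≤s; _<?_)
open import Data.Nat.Properties
  using (+-suc; m≤n⇒m≤1+n; ≮⇒≥; +-monoˡ-≤; ≤-trans; +-cancelˡ-<; +-identityʳ)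
open import Data.Fin using (Fin; zero; suc; _≟_)
open import Data.Product using (Σ; ∃; _×_; _,_; proj₁; proj₂)
open import Data.Product.Properties using (≡-dec)
open import Data.Sum using (_⊎_; inj₁; inj₂)
open import Data.Empty using (⊥-elim)
open import Data.List using (List; _∷_; []; length; map; filter)
open import Data.List.Properties using (length-map)
open import Data.List.Membership.Propositional.Properties using (∈-map⁺; ∈-filter⁺)
open import Relation.Binary.Definitions using (DecidableEquality)
open import Relation.Binary.PropositionalEquality
  using (_≡_; _≢_; refl; sym; cong; subst; subst₂)
open import Relation.Binary.Construct.Closure.ReflexiveTransitive
  using (Star; ε; _◅_; _◅◅_; gmap) renaming (reverse to reverseStar)
open import Relation.Nullary using (¬_; yes; no)
open import Relation.Nullary.Decidable using (_×-dec_; _⊎-dec_)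
open import Relation.Unary using (Pred; Decidable; ∁)
open import Relation.Unary.Properties using (∁?)

+≤<2*⇒<⊎< : ∀ {a b m} k → a + b ≤ m → m < 2 * k → a < k ⊎ b < k
+≤<2*⇒<⊎< {a} {b} k a+b≤m m<2k with a <? k
... | yes a<k = inj₁ a<k
... | no a≮k = inj₂ (+-cancelˡ-< k b k k+b<k+k)
  where
  k+b<k+k : k + b < k + k
  k+b<k+k = ≤-trans (s≤s (≤-trans (+-monoˡ-≤ b (≮⇒≥ a≮k)) a+b≤m))
                    (subst (λ z → _ < k + z) (+-identityʳ k) m<2k)

length-filter-disjoint : {A : Set} {P Q : Pred A 0ℓ} (P? : Decidable P) (Q? : Decidable Q) →
  (∀ {x} → P x → ¬ Q x) → ∀ xs → length (filter P? xs) + length (filter Q? xs) ≤ length xs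
length-filter-disjoint P? Q? disjoint [] = z≤n
length-filter-disjoint P? Q? disjoint (x ∷ xs) with P? x | Q? x
... | yes p | yes q = ⊥-elim (disjoint p q)
... | yes _ | no _  = s≤s (length-filter-disjoint P? Q? disjoint xs)
... | no _  | yes _ = subst (_≤ length (x ∷ xs)) (sym (+-suc (length (filter P? xs)) (length (filter Q? xs))))
                              (s≤s (length-filter-disjoint P? Q? disjoint xs))
... | no _  | no _  = m≤n⇒m≤1+n (length-filter-disjoint P? Q? disjoint xs)

first-step : {V : Set} {A : V → V → Set} {u z : V} → u ≢ z → Star A u z → ∃ (A u)
first-step u≢z ε       = ⊥-elim (u≢z refl)
first-step _   (e ◅ _) = _ , e

distinct-vertex : {V : Set} → DecidableEquality V →
  (Σ V λ p → Σ V λ q → p ≢ q) → (u : V) → ∃ λ z → u ≢ z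
distinct-vertex _≟V_ (p , q , p≢q) u with u ≟V p
... | yes refl = q , p≢q
... | no u≢p   = p , u≢p

neighbour-avoiding : {V : Set} {A : V → V → Set} {k : ℕ} → DecidableEquality V →
  KEdgeConnected A k → (F : List (V × V)) → length F < k → (u : V) → ∃ (deleteEdges A F u)
neighbour-avoiding _≟V_ (two , connected) F ∣F∣<k u =
  let z , u≢z = distinct-vertex _≟V_ two u in first-step u≢z (connected F ∣F∣<k u z)

module _ {n : ℕ} (G : SimpleGraph n) where

  DVertex : Set
  DVertex = Fin n × Fin 2

  DEdge : Set
  DEdge = DVertex × DVertex

  shadow : DEdge → Fin n × Fin n
  shadow ((a , _) , (b , _)) = a , b

  projectEdges : {P : Pred DEdge 0ℓ} → Decidable P → List DEdge → List (Fin n × Fin n)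
  projectEdges P? F = map shadow (filter P? F)

  one-side-few : {P Q : Pred DEdge 0ℓ} (P? : Decidable P) (Q? : Decidable Q) →
    (∀ {e} → P e → ¬ Q e) → (F : List DEdge) {k : ℕ} → length F < 2 * k →
    length (projectEdges P? F) < k ⊎ length (projectEdges Q? F) < k
  one-side-few P? Q? disjoint F {k} =
    +≤<2*⇒<⊎< k (subst₂ (λ a b → a + b ≤ length F)
                         (sym (length-map shadow (filter P? F))) (sym (length-map shadow (filter Q? F)))
                         (length-filter-disjoint P? Q? disjoint F))

  lift-edge : {P : Pred DEdge 0ℓ} (P? : Decidable P) (F : List DEdge) {a b : Fin n} {i j : Fin 2} →
    P ((a , i) , (b , j)) → P ((b , j) , (a , i)) →
    deleteEdges (Adj G) (projectEdges P? F) a b → deleteEdges (DoubleAdj G) F (a , i) (b , j)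
  lift-edge P? F p p′ (ab , ab∉ , ba∉) =
    ab , ab∉ ∘ (λ m → ∈-map⁺ shadow (∈-filter⁺ P? m p)) , ba∉ ∘ (λ m → ∈-map⁺ shadow (∈-filter⁺ P? m p′))

  deleteEdges-sym : (F : List DEdge) {x y : DVertex} →
    deleteEdges (DoubleAdj G) F x y → deleteEdges (DoubleAdj G) F y x
  deleteEdges-sym F {_ , _} {_ , _} (xy , xy∉ , yx∉) = SimpleGraph.sym G xy , yx∉ , xy∉

  InLayer : Fin 2 → Pred DEdge 0ℓ
  InLayer c ((_ , i) , (_ , j)) = i ≡ c × j ≡ c

  inLayer? : (c : Fin 2) → Decidable (InLayer c)
  inLayer? c ((_ , i) , (_ , j)) = (i ≟ c) ×-dec (j ≟ c)

  lift-walk-to-layer : (F : List DEdge) (c : Fin 2) {a b : Fin n} →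
    Star (deleteEdges (Adj G) (projectEdges (inLayer? c) F)) a b →
    Star (deleteEdges (DoubleAdj G) F) (a , c) (b , c)
  lift-walk-to-layer F c = gmap (_, c) (lift-edge (inLayer? c) F (refl , refl) (refl , refl))

  IntoLayer : Fin n → Fin 2 → Fin 2 → Pred DEdge 0ℓ
  IntoLayer u d c (x , y) = (x ≡ (u , d) × proj₂ y ≡ c) ⊎ (y ≡ (u , d) × proj₂ x ≡ c)

  intoLayer? : (u : Fin n) (d c : Fin 2) → Decidable (IntoLayer u d c)
  intoLayer? u d c (x , y) = ((x ≟D (u , d)) ×-dec (proj₂ y ≟ c)) ⊎-dec ((y ≟D (u , d)) ×-dec (proj₂ x ≟ c))
    where
    _≟D_ : DecidableEquality DVertex
    _≟D_ = ≡-dec _≟_ _≟_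

  module _ {k : ℕ} (hG : KEdgeConnected (Adj G) k) (F : List DEdge) (∣F∣<2k : length F < 2 * k) where

    cross-to-layer : (u : Fin n) {d c : Fin 2} → d ≢ c →
      ∃ λ b → Star (deleteEdges (DoubleAdj G) F) (u , d) (b , c)
    cross-to-layer u {d} {c} d≢c
      with one-side-few (intoLayer? u d c) (∁? (intoLayer? u d c)) (λ p ¬p → ¬p p) F ∣F∣<2k
    ... | inj₁ few =
      let b , ub = neighbour-avoiding _≟_ hG _ few u
      in b , lift-edge (intoLayer? u d c) F (inj₁ (refl , refl)) (inj₂ (refl , refl)) ub ◅ ε
    ... | inj₂ few with neighbour-avoiding _≟_ hG _ few u
    ... | a , ua with neighbour-avoiding _≟_ hG _ few a
    ... | b , ab = b , lift-edge avoid? F within-d within-d ua ◅ lift-edge avoid? F leave-a enter-a ab ◅ ε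
      where
      avoid? : Decidable (∁ (IntoLayer u d c))
      avoid? = ∁? (intoLayer? u d c)

      a≢u : a ≢ u
      a≢u refl = SimpleGraph.irrefl G (proj₁ ua)

      within-d : {x y : Fin n} → ¬ IntoLayer u d c ((x , d) , (y , d))
      within-d (inj₁ (_ , d≡c)) = d≢c d≡c
      within-d (inj₂ (_ , d≡c)) = d≢c d≡c

      leave-a : ¬ IntoLayer u d c ((a , d) , (b , c))
      leave-a (inj₁ (a≡u , _)) = a≢u (cong proj₁ a≡u)
      leave-a (inj₂ (c≡d , _)) = d≢c (sym (cong proj₂ c≡d))

      enter-a : ¬ IntoLayer u d c ((b , c) , (a , d))
      enter-a (inj₁ (c≡d , _)) = d≢c (sym (cong proj₂ c≡d))
      enter-a (inj₂ (a≡u , _)) = a≢u (cong proj₁ a≡u)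

    reach-layer : (c : Fin 2) (x : DVertex) → ∃ λ b → Star (deleteEdges (DoubleAdj G) F) x (b , c)
    reach-layer c (u , i) with i ≟ c
    ... | yes refl = u , ε
    ... | no i≢c   = cross-to-layer u i≢c

    connected-via-layer : (c : Fin 2) → length (projectEdges (inLayer? c) F) < k →
      Connected (deleteEdges (DoubleAdj G) F)
    connected-via-layer c few x y =
      let b , x⇝b = reach-layer c x
          b′ , y⇝b′ = reach-layer c y
      in x⇝b ◅◅ lift-walk-to-layer F c (proj₂ hG _ few b b′) ◅◅ reverseStar (deleteEdges-sym F) y⇝b′

proposition3p1 : (n : ℕ) (G : SimpleGraph n) → Connected (Adj G) →
    (k : ℕ) → KEdgeConnected (Adj G) k → KEdgeConnected (DoubleAdj G) (2 * k)
proposition3p1 _ G _ k hG@((p , q , p≢q) , _) = ((p , zero) , (q , zero) , p≢q ∘ cong proj₁) , connected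
  where
  layers-disjoint : ∀ {e} → InLayer G zero e → ¬ InLayer G (suc zero) e
  layers-disjoint (refl , _) (() , _)

  connected : (F : List (DEdge G)) → length F < 2 * k → Connected (deleteEdges (DoubleAdj G) F)
  connected F ∣F∣<2k
    with one-side-few G (inLayer? G zero) (inLayer? G (suc zero)) (λ {e} → layers-disjoint {e}) F ∣F∣<2k
  ... | inj₁ few = connected-via-layer G hG F ∣F∣<2k zero few
  ... | inj₂ few = connected-via-layer G hG F ∣F∣<2k (suc zero) few
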